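{- Let $m\ge 2$, $n\ge 2$, let $K_m$ be the complete graph on $m$ vertices and $P_n$ the path on $n$ vertices, and let $\Delta$ be the maximum degree of $K_m\times P_n$. Then $\chi''_{\Sigma}(K_m\times P_n)=\Delta+2$.
   Context: All graphs are finite and simple. A proper total $k$-coloring of a graph $G$ assigns to every vertex and every edge a color from $\{1,\dots,k\}$ such that adjacent vertices receive different colors, edges sharing an endpoint receive different colors, and no edge receives the same color as either of its endpoints. For such a coloring $c$ and a vertex $v$, let $f(v)=c(v)+\sum_{e\ni v} c(e)$. The coloring distinguishes adjacent vertices by sums if $f(u)\neq f(v)$ for every edge $uv$. $\chi''_{\Sigma}(G)$ denotes the smallest $k$ such that $G$ has a proper total $k$-coloring distinguishing adjacent vertices by sums. The product $G_1\times G_2$ is the Cartesian product: vertex set $V(G_1)\times V(G_2)$, with $(u_1,u_2)$ adjacent to $(v_1,v_2)$ iff either $u_1=v_1$ and $u_2v_2\in E(G_2)$, or $u_1v_1\in E(G_1)$ and $u_2=v_2$. -}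

module Defs where

open import Data.Nat using (ℕ; zero; suc; _+_; _*_; _⊔_; _<_; _∸_)
open import Data.Nat.Base using (∣_-_∣)
open import Data.Fin using (Fin; toℕ; remQuot)
open import Data.Fin.Properties using () renaming (_≟_ to _≟ᶠ_)
open import Data.Bool using (Bool; true; false; if_then_else_; not; _∧_; _∨_)
open import Data.List using (List; map; foldr; allFin)
open import Data.Nat.ListAction using (sum)
open import Data.Product using (Σ; _×_; proj₁; proj₂)
open import Relation.Nullary using (¬_)
open import Relation.Nullary.Decidable using (⌊_⌋)
open import Relation.Binary.PropositionalEquality using (_≡_; _≢_)
import Data.Nat as ℕ

-- A finite simple graph on vertex set Fin size, given by a Boolean
-- adjacency relation (the graphs used below are symmetric and loopless).
record Graph : Set where
  field
    size : ℕ
    adj  : Fin size → Fin size → Bool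
open Graph public

K : ℕ → Graph
K m = record { size = m ; adj = λ i j → not ⌊ i ≟ᶠ j ⌋ }

P : ℕ → Graph
P n = record { size = n ; adj = λ i j → ⌊ ∣ toℕ i - toℕ j ∣ ℕ.≟ 1 ⌋ }

-- Cartesian product; vertex set Fin (|G|*|H|) ≅ Fin |G| × Fin |H| via remQuot.
_□_ : Graph → Graph → Graph
G □ H = record { size = size G * size H ; adj = a }
  where
  a : Fin (size G * size H) → Fin (size G * size H) → Bool
  rq : Fin (size G * size H) → Fin (size G) × Fin (size H)
  rq = remQuot {size G} (size H)
  a x y = (⌊ proj₁ (rq x) ≟ᶠ proj₁ (rq y) ⌋
             ∧ adj H (proj₂ (rq x)) (proj₂ (rq y)))
          ∨ (adj G (proj₁ (rq x)) (proj₁ (rq y))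
             ∧ ⌊ proj₂ (rq x) ≟ᶠ proj₂ (rq y) ⌋)

degree : (G : Graph) → Fin (size G) → ℕ
degree G v = sum (map (λ u → if adj G v u then 1 else 0) (allFin (size G)))

maxDegree : Graph → ℕ
maxDegree G = foldr _⊔_ 0 (map (degree G) (allFin (size G)))

-- Colors {1,…,k} are represented by Fin k; color i : Fin k has value toℕ i + 1.
val : {k : ℕ} → Fin k → ℕ
val i = suc (toℕ i)

-- A total coloring: vertex colors and edge colors (ec u v is the color of
-- edge uv; only meaningful when u ~ v).
record TotalColoring (G : Graph) (k : ℕ) : Set where
  field
    vc : Fin (size G) → Fin k
    ec : Fin (size G) → Fin (size G) → Fin k

weight : {G : Graph} {k : ℕ} → TotalColoring G k → Fin (size G) → ℕ
weight {G} c v =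
  val (TotalColoring.vc c v)
  + sum (map (λ u → if adj G v u then val (TotalColoring.ec c v u) else 0)
             (allFin (size G)))

record IsProperSumDistinguishing (G : Graph) (k : ℕ) (c : TotalColoring G k) : Set where
  open TotalColoring c
  field
    edge-sym      : ∀ u v → adj G u v ≡ true → ec u v ≡ ec v u
    vertex-proper : ∀ u v → adj G u v ≡ true → vc u ≢ vc v
    edge-proper   : ∀ u v w → adj G u v ≡ true → adj G u w ≡ true → v ≢ w → ec u v ≢ ec u w
    incidence     : ∀ u v → adj G u v ≡ true → ec u v ≢ vc u
    sums-distinct : ∀ u v → adj G u v ≡ true → weight c u ≢ weight c v

HasNSDTC : Graph → ℕ → Set
HasNSDTC G k = Σ (TotalColoring G k) (IsProperSumDistinguishing G k)

ChiSigmaIs : Graph → ℕ → Set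
ChiSigmaIs G k = HasNSDTC G k × (∀ j → j < k → ¬ HasNSDTC G j)

-- Lower bound, valid in every graph: the colours of a vertex v and of its deg v edges are
-- pairwise distinct, so a proper total k-colouring has k ≥ deg v + 1, and if k = deg v + 1 then
-- f(v) = 1 + 2 + ⋯ + k.  Two adjacent vertices of maximum degree Δ would then get equal sums,
-- so χ''Σ ≥ Δ + 2; in K m □ P n the vertices (0, j) and (1, j) of a column of degree Δ are such
-- a pair.
--
-- Upper bound: let M ∈ {m + 1, m + 2} be odd.  Colour the j-th copy of K m by (i + i' + s j) mod M,
-- vertices included (i = i'), where the shift s j alternates between two consecutive values, so
-- that vertically adjacent vertices differ.  Every vertex then misses M - m of the colours below M
-- and its K m part weighs 1 + ⋯ + M minus the missing colours.  A path edge gets a colour missing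
-- at both of its ends or an extra colour (M, M + 1 for m even; M for m odd), and the alternation
-- of the shifts and of these path colours separates the sums of adjacent vertices.

module Submission where

open import Defs
open import Data.Nat using (ℕ; zero; suc; _+_; _*_; _∸_; _≤_; _<_; _<ᵇ_; _⊓_; NonZero; z≤n; s≤s; z<s; s≤s⁻¹; >-nonZero⁻¹)
open import Data.Nat.Base using (∣_-_∣)
import Data.Nat as ℕ
open import Data.Nat.Properties hiding (0≢1+n)
open import Data.Nat.DivMod using (_%_; _mod_; m<n⇒m%n≡m; m≤n⇒[n∸m]%m≡n%m; %-distribˡ-+; [m+n]%n≡m%n; m%n<n)
open import Data.Nat.Tactic.RingSolver using (solve-∀)
import Data.Nat.ListAction as List
open import Data.Fin using (Fin; zero; suc; toℕ; combine; remQuot; punchIn; punchOut; _↑ˡ_; _↑ʳ_)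
open import Data.Fin.Properties
  using (punchIn-punchOut; punchOut-injective; punchInᵢ≢i; 0≢1+n; injective⇒≤; remQuot-combine; combine-remQuot;
         toℕ<n; toℕ-fromℕ<; toℕ-injective; toℕ-↑ˡ; toℕ-↑ʳ)
  renaming (suc-injective to fsuc-injective; _≟_ to _≟ᶠ_)
open import Data.Bool using (Bool; true; false; if_then_else_; not; _∧_; _∨_)
open import Data.Bool.Properties using (∨-identityʳ; T-≡)
open import Data.Product using (Σ; Σ-syntax; _×_; _,_; proj₁; proj₂; uncurry)
open import Data.Sum using (_⊎_; inj₁; inj₂; [_,_])
open import Data.List using (map; allFin; tabulate)
open import Data.List.Properties using (map-tabulate; foldr-preservesᵇ; foldr-preservesᵒ)
import Data.List.Relation.Unary.All.Properties as All
import Data.List.Relation.Unary.Any as Any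
import Data.List.Relation.Unary.Any.Properties as Any
open import Data.List.Membership.Propositional.Properties using (∈-allFin)
open import Function using (_∘_; id)
open import Function.Bundles using (Equivalence)
open import Function.Definitions using (Injective)
open import Relation.Nullary using (¬_; yes; no; does; contradiction)
open import Relation.Nullary.Decidable using (⌊_⌋; dec-true; dec-false)
open import Relation.Binary.PropositionalEquality
  using (_≡_; _≢_; refl; sym; trans; cong; cong₂; subst; ≡-≟-identity; ≢-≟-identity; module ≡-Reasoning)
open import Algebra.Properties.CommutativeMonoid.Sum +-0-commutativeMonoid
  using (sum; sum-syntax; sum-cong-≗; sum-remove; sum-replicate-zero)

-- Finite sums

sum-map-allFin : ∀ n (f : Fin n → ℕ) → List.sum (map f (allFin n)) ≡ ∑[ i < n ] f i
sum-map-allFin n f = trans (cong List.sum (map-tabulate id f)) (go n f)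
  where
  go : ∀ n (f : Fin n → ℕ) → List.sum (tabulate f) ≡ sum f
  go zero    f = refl
  go (suc n) f = cong (f zero +_) (go n (f ∘ suc))

∑-ones : ∀ n → ∑[ _ < n ] 1 ≡ n
∑-ones zero    = refl
∑-ones (suc n) = cong suc (∑-ones n)

∑-↑ : ∀ m n (f : Fin (m + n) → ℕ) → ∑[ i < m + n ] f i ≡ ∑[ i < m ] f (i ↑ˡ n) + ∑[ i < n ] f (m ↑ʳ i)
∑-↑ zero    n f = refl
∑-↑ (suc m) n f = trans (cong (f zero +_) (∑-↑ m n (f ∘ suc))) (sym (+-assoc (f zero) _ _))

∑-combine : ∀ m n (f : Fin (m * n) → ℕ) → ∑[ x < m * n ] f x ≡ ∑[ i < m ] ∑[ j < n ] f (combine i j)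
∑-combine zero    n f = refl
∑-combine (suc m) n f = trans (∑-↑ n (m * n) f) (cong (∑[ j < n ] f (j ↑ˡ (m * n)) +_) (∑-combine m n (f ∘ (n ↑ʳ_))))

∑-injective : ∀ n (σ : Fin n → Fin n) → Injective _≡_ _≡_ σ → (f : Fin n → ℕ) → ∑[ i < n ] f (σ i) ≡ ∑[ i < n ] f i
∑-injective zero    σ σ-inj f = refl
∑-injective (suc n) σ σ-inj f = begin
  f (σ zero) + ∑[ i < n ] f (σ (suc i))
    ≡⟨ cong (f (σ zero) +_) (sum-cong-≗ (cong f ∘ sym ∘ punchIn-punchOut ∘ σ₀≢)) ⟩
  f (σ zero) + ∑[ i < n ] f (punchIn (σ zero) (τ i))
    ≡⟨ cong (f (σ zero) +_) (∑-injective n τ τ-inj (f ∘ punchIn (σ zero))) ⟩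
  f (σ zero) + ∑[ i < n ] f (punchIn (σ zero) i)
    ≡⟨ sum-remove f ⟨
  ∑[ i < suc n ] f i
    ∎
  where
  open ≡-Reasoning
  σ₀≢ : ∀ i → σ zero ≢ σ (suc i)
  σ₀≢ i = 0≢1+n ∘ σ-inj
  τ : Fin n → Fin n
  τ i = punchOut (σ₀≢ i)
  τ-inj : Injective _≡_ _≡_ τ
  τ-inj {i} {j} eq = fsuc-injective (σ-inj (punchOut-injective (σ₀≢ i) (σ₀≢ j) eq))

∑-if-≟ : ∀ n (i : Fin (suc n)) (g f : Fin (suc n) → ℕ) →
         ∑[ x < suc n ] (if ⌊ i ≟ᶠ x ⌋ then g x else f x) ≡ g i + ∑[ r < n ] f (punchIn i r)
∑-if-≟ n i g f = begin
  ∑[ x < suc n ] (if ⌊ i ≟ᶠ x ⌋ then g x else f x)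
    ≡⟨ sum-remove {i = i} (λ x → if ⌊ i ≟ᶠ x ⌋ then g x else f x) ⟩
  (if ⌊ i ≟ᶠ i ⌋ then g i else f i) + ∑[ r < n ] (if ⌊ i ≟ᶠ punchIn i r ⌋ then g (punchIn i r) else f (punchIn i r))
    ≡⟨ cong₂ _+_ (cong (λ d → if ⌊ d ⌋ then g i else f i) (≡-≟-identity _≟ᶠ_ refl)) (sum-cong-≗ otherwise) ⟩
  g i + ∑[ r < n ] f (punchIn i r)
    ∎
  where
  open ≡-Reasoning
  otherwise : ∀ r → (if ⌊ i ≟ᶠ punchIn i r ⌋ then g (punchIn i r) else f (punchIn i r)) ≡ f (punchIn i r)
  otherwise r = cong (λ d → if ⌊ d ⌋ then g (punchIn i r) else f (punchIn i r)) (≢-≟-identity _≟ᶠ_ (punchInᵢ≢i i r ∘ sym))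

∑-point : ∀ n (j : Fin n) (f : Fin n → ℕ) → ∑[ t < n ] (if ⌊ j ≟ᶠ t ⌋ then f t else 0) ≡ f j
∑-point (suc n) j f = trans (∑-if-≟ n j f (λ _ → 0)) (trans (cong (f j +_) (sum-replicate-zero n)) (+-identityʳ (f j)))

∑-if-cong : ∀ n (b : Fin n → Bool) {f g : Fin n → ℕ} → (∀ x → b x ≡ true → f x ≡ g x) →
            ∑[ x < n ] (if b x then f x else 0) ≡ ∑[ x < n ] (if b x then g x else 0)
∑-if-cong n b f≐g = sum-cong-≗ pointwise
  where
  pointwise : ∀ x → (if b x then _ else 0) ≡ (if b x then _ else 0)
  pointwise x with b x in bx
  ... | true  = f≐g x bx
  ... | false = refl

-- A lower bound in every graph

record Enumeration {N : ℕ} (p : Fin N → Bool) : Set where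
  field
    count      : ℕ
    element    : Fin count → Fin N
    injective  : Injective _≡_ _≡_ element
    sound      : ∀ x → p (element x) ≡ true
    ∑-restrict : ∀ (f : Fin N → ℕ) → ∑[ u < N ] (if p u then f u else 0) ≡ ∑[ x < count ] f (element x)

enumerate : ∀ {N} (p : Fin N → Bool) → Enumeration p
enumerate {zero}  p = record { count = 0 ; element = λ () ; injective = λ {} ; sound = λ () ; ∑-restrict = λ _ → refl }
enumerate {suc N} p with p zero in p₀ | enumerate (p ∘ suc)
... | false | E = record
  { count      = count
  ; element    = suc ∘ element
  ; injective  = injective ∘ fsuc-injective
  ; sound      = sound
  ; ∑-restrict = restrict
  }
  where
  open Enumeration E
  restrict : ∀ (f : Fin (suc N) → ℕ) → ∑[ u < suc N ] (if p u then f u else 0) ≡ ∑[ x < count ] f (suc (element x))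
  restrict f rewrite p₀ = ∑-restrict (f ∘ suc)
... | true  | E = record
  { count      = suc count
  ; element    = element′
  ; injective  = λ {x} {y} → injective′ x y
  ; sound      = λ { zero → p₀ ; (suc x) → sound x }
  ; ∑-restrict = restrict
  }
  where
  open Enumeration E
  element′ : Fin (suc count) → Fin (suc N)
  element′ zero    = zero
  element′ (suc x) = suc (element x)
  injective′ : ∀ x y → element′ x ≡ element′ y → x ≡ y
  injective′ zero    zero    _  = refl
  injective′ zero    (suc y) ()
  injective′ (suc x) zero    ()
  injective′ (suc x) (suc y) eq = cong suc (injective (fsuc-injective eq))
  restrict : ∀ (f : Fin (suc N) → ℕ) → ∑[ u < suc N ] (if p u then f u else 0) ≡ ∑[ x < suc count ] f (element′ x)
  restrict f rewrite p₀ = cong (f zero +_) (∑-restrict (f ∘ suc))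

module _ {G : Graph} {k : ℕ} {c : TotalColoring G k} (proper : IsProperSumDistinguishing G k c) (v : Fin (size G)) where
  open TotalColoring c
  open IsProperSumDistinguishing proper
  open Enumeration (enumerate (adj G v))

  private
    coloursAt : Fin (suc count) → Fin k
    coloursAt zero    = vc v
    coloursAt (suc x) = ec v (element x)

    coloursAt-injective : Injective _≡_ _≡_ coloursAt
    coloursAt-injective {zero}  {zero}  _  = refl
    coloursAt-injective {zero}  {suc y} eq = contradiction (sym eq) (incidence v (element y) (sound y))
    coloursAt-injective {suc x} {zero}  eq = contradiction eq (incidence v (element x) (sound x))
    coloursAt-injective {suc x} {suc y} eq with x ≟ᶠ y
    ... | yes x≡y = cong suc x≡y
    ... | no  x≢y = contradiction eq (edge-proper v _ _ (sound x) (sound y) (x≢y ∘ injective))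

    degree≡count : degree G v ≡ count
    degree≡count = begin
      degree G v                                      ≡⟨ sum-map-allFin (size G) _ ⟩
      ∑[ u < size G ] (if adj G v u then 1 else 0)    ≡⟨ ∑-restrict (λ _ → 1) ⟩
      ∑[ _ < count ] 1                                ≡⟨ ∑-ones count ⟩
      count                                           ∎
      where open ≡-Reasoning

    weight≡∑coloursAt : weight c v ≡ ∑[ x < suc count ] val (coloursAt x)
    weight≡∑coloursAt = cong (val (vc v) +_) (trans (sum-map-allFin (size G) _) (∑-restrict (val ∘ ec v)))

  degree<colours : degree G v < k
  degree<colours = subst (_< k) (sym degree≡count) (injective⇒≤ coloursAt-injective)

  weight≡∑colours : k ≡ suc (degree G v) → weight c v ≡ ∑[ a < k ] val a
  weight≡∑colours k≡ with trans k≡ (cong suc degree≡count)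
  ... | refl = trans weight≡∑coloursAt (∑-injective k coloursAt coloursAt-injective val)

adjacent-equal-degree⇒¬HasNSDTC : ∀ G {u v} → adj G u v ≡ true → degree G u ≡ degree G v →
                                   ∀ k → k ≤ suc (degree G u) → ¬ HasNSDTC G k
adjacent-equal-degree⇒¬HasNSDTC G {u} {v} u~v du≡dv k k≤ (c , proper) = sums-distinct u v u~v
  (trans (weight≡∑colours proper u k≡du) (sym (weight≡∑colours proper v (trans k≡du (cong suc du≡dv)))))
  where
  open IsProperSumDistinguishing proper
  k≡du : k ≡ suc (degree G u)
  k≡du = ≤-antisym k≤ (degree<colours proper u)

maxDegree≡ : ∀ G {Δ} → (∀ v → degree G v ≤ Δ) → ∀ v → degree G v ≡ Δ → maxDegree G ≡ Δ
maxDegree≡ G {Δ} deg≤Δ v deg≡Δ = ≤-antisym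
  (foldr-preservesᵇ {P = _≤ Δ} ⊔-lub z≤n (All.map⁺ (All.tabulate⁺ deg≤Δ)))
  (foldr-preservesᵒ {P = Δ ≤_} (λ x y → [ (λ Δ≤x → ≤-trans Δ≤x (m≤m⊔n x y)) , (λ Δ≤y → ≤-trans Δ≤y (m≤n⊔m x y)) ]) 0 _
    (inj₂ (Any.map⁺ (Any.map (λ { refl → ≤-reflexive (sym deg≡Δ) }) (∈-allFin v)))))

χ''Σ≡Δ+2 : ∀ G {u v} → adj G u v ≡ true → degree G u ≡ maxDegree G → degree G v ≡ maxDegree G →
           HasNSDTC G (maxDegree G + 2) → ChiSigmaIs G (maxDegree G + 2)
χ''Σ≡Δ+2 G u~v du≡Δ dv≡Δ colouring = colouring , λ k k<Δ+2 →
  adjacent-equal-degree⇒¬HasNSDTC G u~v (trans du≡Δ (sym dv≡Δ)) k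
    (≤-trans (s≤s⁻¹ (subst (k <_) (+-comm (maxDegree G) 2) k<Δ+2)) (≤-reflexive (cong suc (sym du≡Δ))))

-- The graph K m □ P n

-- h at the path edges {j - 1, j} and {j, j + 1} of P n, edge {p, p + 1} being indexed by p; 0 if absent
leftEdge : ℕ → (ℕ → ℕ) → ℕ
leftEdge zero    h = 0
leftEdge (suc p) h = h p

rightEdge : ℕ → ℕ → (ℕ → ℕ) → ℕ
rightEdge n j h = if suc j <ᵇ n then h j else 0

rightEdge-inner : ∀ {n j} (h : ℕ → ℕ) → suc j < n → rightEdge n j h ≡ h j
rightEdge-inner {j = j} h 1+j<n = cong (if_then h j else 0) (Equivalence.to T-≡ (<⇒<ᵇ 1+j<n))

rightEdge-cases : ∀ n j (h : ℕ → ℕ) → rightEdge n j h ≡ 0 ⊎ rightEdge n j h ≡ h j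
rightEdge-cases n j h with suc j <ᵇ n
... | false = inj₁ refl
... | true  = inj₂ refl

∑-pathEdges : ∀ n j (h : ℕ → ℕ) → j < n →
  ∑[ t < n ] (if ⌊ ∣ j - toℕ t ∣ ℕ.≟ 1 ⌋ then h (j ⊓ toℕ t) else 0) ≡ leftEdge j h + rightEdge n j h
∑-pathEdges (suc zero)     zero          h _ = refl
∑-pathEdges (suc (suc n))  zero          h _ = trans (cong (h 0 +_) (sum-replicate-zero n)) (+-identityʳ (h 0))
∑-pathEdges (suc n)        (suc zero)    h (s≤s j<n) = cong (h 0 +_) (∑-pathEdges n 0 (h ∘ suc) j<n)
∑-pathEdges (suc n)        (suc (suc j)) h (s≤s j<n) = ∑-pathEdges n (suc j) (h ∘ suc) j<n

∑-pathNeighbours : ∀ {n} (j : Fin n) (F : Fin n → ℕ) (h : ℕ → ℕ) →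
  (∀ t → adj (P n) j t ≡ true → F t ≡ h (toℕ j ⊓ toℕ t)) →
  ∑[ t < n ] (if adj (P n) j t then F t else 0) ≡ leftEdge (toℕ j) h + rightEdge n (toℕ j) h
∑-pathNeighbours {n} j F h F≐h =
  trans (∑-if-cong n (adj (P n) j) F≐h) (∑-pathEdges n (toℕ j) h (toℕ<n j))

adj-combine : ∀ {m n} (i i' : Fin m) (j j' : Fin n) →
  adj (K m □ P n) (combine i j) (combine i' j') ≡ (⌊ i ≟ᶠ i' ⌋ ∧ adj (P n) j j') ∨ (not ⌊ i ≟ᶠ i' ⌋ ∧ ⌊ j ≟ᶠ j' ⌋)
adj-combine {m} {n} i i' j j' =
  cong₂ adjacentCoordinates (remQuot-combine {m} {n} i j) (remQuot-combine {m} {n} i' j')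
  where
  adjacentCoordinates : Fin m × Fin n → Fin m × Fin n → Bool
  adjacentCoordinates (i , j) (i' , j') = (⌊ i ≟ᶠ i' ⌋ ∧ adj (P n) j j') ∨ (not ⌊ i ≟ᶠ i' ⌋ ∧ ⌊ j ≟ᶠ j' ⌋)

∑-neighbours : ∀ {m' n} (i : Fin (suc m')) (j : Fin n) (F : Fin (suc m' * n) → ℕ) →
  ∑[ w < suc m' * n ] (if adj (K (suc m') □ P n) (combine i j) w then F w else 0)
  ≡ ∑[ t < n ] (if adj (P n) j t then F (combine i t) else 0) + ∑[ r < m' ] F (combine (punchIn i r) j)
∑-neighbours {m'} {n} i j F = begin
  ∑[ w < suc m' * n ] (if adj G (combine i j) w then F w else 0)
    ≡⟨ ∑-combine (suc m') n _ ⟩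
  ∑[ i' < suc m' ] ∑[ t < n ] (if adj G (combine i j) (combine i' t) then F (combine i' t) else 0)
    ≡⟨ sum-cong-≗ column ⟩
  ∑[ i' < suc m' ] (if ⌊ i ≟ᶠ i' ⌋ then pathPart else F (combine i' j))
    ≡⟨ ∑-if-≟ m' i (λ _ → pathPart) (λ i' → F (combine i' j)) ⟩
  pathPart + ∑[ r < m' ] F (combine (punchIn i r) j)
    ∎
  where
  open ≡-Reasoning
  G = K (suc m') □ P n
  pathPart = ∑[ t < n ] (if adj (P n) j t then F (combine i t) else 0)
  column : ∀ i' → ∑[ t < n ] (if adj G (combine i j) (combine i' t) then F (combine i' t) else 0)
                  ≡ (if ⌊ i ≟ᶠ i' ⌋ then pathPart else F (combine i' j))
  column i' rewrite sum-cong-≗ (λ t → cong (if_then F (combine i' t) else 0) (adj-combine i i' j t)) with i ≟ᶠ i'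
  ... | yes refl = sum-cong-≗ (λ t → cong (if_then F (combine i t) else 0) (∨-identityʳ _))
  ... | no  _    = ∑-point n j (λ t → F (combine i' t))

pathDegree : ℕ → ℕ → ℕ
pathDegree n j = leftEdge j (λ _ → 1) + rightEdge n j (λ _ → 1)

degree-combine : ∀ {m' n} (i : Fin (suc m')) (j : Fin n) →
  degree (K (suc m') □ P n) (combine i j) ≡ pathDegree n (toℕ j) + m'
degree-combine {m'} {n} i j = begin
  degree (K (suc m') □ P n) (combine i j)
    ≡⟨ sum-map-allFin (suc m' * n) _ ⟩
  ∑[ w < suc m' * n ] (if adj (K (suc m') □ P n) (combine i j) w then 1 else 0)
    ≡⟨ ∑-neighbours i j (λ _ → 1) ⟩
  ∑[ t < n ] (if adj (P n) j t then 1 else 0) + ∑[ _ < m' ] 1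
    ≡⟨ cong₂ _+_ (∑-pathNeighbours j (λ _ → 1) (λ _ → 1) (λ _ _ → refl)) (∑-ones m') ⟩
  pathDegree n (toℕ j) + m'
    ∎
  where open ≡-Reasoning

∀-combine : ∀ {m n} {Q : Fin (m * n) → Set} → (∀ (i : Fin m) (j : Fin n) → Q (combine i j)) → ∀ u → Q u
∀-combine {m} {n} {Q} Q-combine u =
  subst Q (combine-remQuot {m} n u) (Q-combine (proj₁ (remQuot {m} n u)) (proj₂ (remQuot {m} n u)))

pathDegree≤2 : ∀ n j → pathDegree n j ≤ 2
pathDegree≤2 n j = +-mono-≤ (leftEdge≤1 j) (rightEdge≤1 (suc j <ᵇ n))
  where
  leftEdge≤1 : ∀ j → leftEdge j (λ _ → 1) ≤ 1
  leftEdge≤1 zero    = z≤n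
  leftEdge≤1 (suc j) = ≤-refl
  rightEdge≤1 : ∀ b → (if b then 1 else 0) ≤ 1
  rightEdge≤1 true  = ≤-refl
  rightEdge≤1 false = z≤n

maxDegree-K□P₂ : ∀ m' → maxDegree (K (suc m') □ P 2) ≡ 1 + m'
maxDegree-K□P₂ m' = maxDegree≡ (K (suc m') □ P 2)
  (∀-combine {suc m'} {2} (λ i j → ≤-reflexive (degree≡ i j))) (combine {suc m'} {2} zero zero) (degree≡ zero zero)
  where
  degree≡ : ∀ (i : Fin (suc m')) (j : Fin 2) → degree (K (suc m') □ P 2) (combine i j) ≡ 1 + m'
  degree≡ i zero       = degree-combine {m'} {2} i zero
  degree≡ i (suc zero) = degree-combine {m'} {2} i (suc zero)

maxDegree-K□P₃₊ : ∀ m' n' → maxDegree (K (suc m') □ P (3 + n')) ≡ 2 + m'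
maxDegree-K□P₃₊ m' n' = maxDegree≡ (K (suc m') □ P (3 + n'))
  (∀-combine {suc m'} {3 + n'} degree≤) (combine {suc m'} {3 + n'} zero (suc zero)) (degree-combine {m'} {3 + n'} zero (suc zero))
  where
  degree≤ : ∀ (i : Fin (suc m')) (j : Fin (3 + n')) → degree (K (suc m') □ P (3 + n')) (combine i j) ≤ 2 + m'
  degree≤ i j = subst (_≤ 2 + m') (sym (degree-combine i j)) (+-monoˡ-≤ m' (pathDegree≤2 (3 + n') (toℕ j)))

K□P-χ''Σ : ∀ m' n (j : Fin n) → maxDegree (K (2 + m') □ P n) ≡ pathDegree n (toℕ j) + suc m' →
  HasNSDTC (K (2 + m') □ P n) (pathDegree n (toℕ j) + suc m' + 2) →
  ChiSigmaIs (K (2 + m') □ P n) (maxDegree (K (2 + m') □ P n) + 2)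
K□P-χ''Σ m' n j Δ≡ colouring = χ''Σ≡Δ+2 G {vertex zero} {vertex (suc zero)} column-edge
  (trans (degree-combine {suc m'} zero j) (sym Δ≡)) (trans (degree-combine {suc m'} (suc zero) j) (sym Δ≡))
  (subst (λ Δ → HasNSDTC G (Δ + 2)) (sym Δ≡) colouring)
  where
  G = K (2 + m') □ P n
  vertex : Fin (2 + m') → Fin (size G)
  vertex i = combine i j
  column-edge : adj G (vertex zero) (vertex (suc zero)) ≡ true
  column-edge = trans (adj-combine zero (suc zero) j j) (cong ⌊_⌋ (≡-≟-identity _≟ᶠ_ refl))

-- adjacency of (i, j) and (i', j') in K m □ P n, where i indexes K m and j indexes P n
data _∼_ : ℕ × ℕ → ℕ × ℕ → Set where
  column   : ∀ {i i' j} → i ≢ i' → (i , j) ∼ (i' , j)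
  forward  : ∀ {i j} → (i , j) ∼ (i , suc j)
  backward : ∀ {i j} → (i , suc j) ∼ (i , j)

pathAdjacent : ∀ {a b} x → ⌊ ∣ a - b ∣ ℕ.≟ 1 ⌋ ≡ true → (x , a) ∼ (x , b)
pathAdjacent {zero}        {suc zero}    x _ = forward
pathAdjacent {suc zero}    {zero}        x _ = backward
pathAdjacent {suc a}       {suc b}       x a~b with pathAdjacent {a} {b} x a~b
... | column x≢x = contradiction refl x≢x
... | forward    = forward
... | backward   = backward
pathAdjacent {zero}        {zero}        x ()
pathAdjacent {zero}        {suc (suc b)} x ()
pathAdjacent {suc (suc a)} {zero}        x ()

-- κ j i i' colours the edge (i, j)(i', j) and κ j i i the vertex (i, j); π i p colours the edge (i, p)(i, p + 1).
module CoordinateColouring (m' n k' : ℕ) (κ : ℕ → ℕ → ℕ → ℕ) (π : ℕ → ℕ → ℕ) where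

  private
    m = suc m'
    k = suc k'

  coordinateWeight : ℕ → ℕ → ℕ
  coordinateWeight i j = ∑[ i' < m ] suc (κ j i (toℕ i')) + (leftEdge j (suc ∘ π i) + rightEdge n j (suc ∘ π i))

  record Admissible : Set where
    field
      κ<k                  : ∀ {j i i'} → i < m → i' < m → κ j i i' < k
      π<k                  : ∀ {i p} → i < m → suc p < n → π i p < k
      κ-comm               : ∀ j i i' → κ j i i' ≡ κ j i' i
      κ-injective          : ∀ {j i i' i''} → i < m → i' < m → i'' < m → κ j i i' ≡ κ j i i'' → i' ≡ i''
      κ-diagonal-injective : ∀ {j i i'} → i < m → i' < m → κ j i i ≡ κ j i' i' → i ≡ i'
      κ-diagonal-step      : ∀ {j i} → i < m → κ j i i ≢ κ (suc j) i i
      π-avoids-κ           : ∀ {i i' p j} → i < m → i' < m → (j ≡ p ⊎ j ≡ suc p) → π i p ≢ κ j i i'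
      π-step               : ∀ {i p} → i < m → π i p ≢ π i (suc p)
      weight-column        : ∀ {i i' j} → i < m → i' < m → i ≢ i' → coordinateWeight i j ≢ coordinateWeight i' j
      weight-row           : ∀ {i j} → i < m → suc j < n → coordinateWeight i j ≢ coordinateWeight i (suc j)

  vertexColour : ℕ × ℕ → ℕ
  vertexColour (i , j) = κ j i i

  edgeColour : ℕ × ℕ → ℕ × ℕ → ℕ
  edgeColour (i , j) (i' , j') = if does (i ℕ.≟ i') then π i (j ⊓ j') else κ j i i'

  coordinates : Fin (m * n) → ℕ × ℕ
  coordinates u = toℕ (proj₁ (remQuot {m} n u)) , toℕ (proj₂ (remQuot {m} n u))

  -- only ever applied to colours below k, where it is the identity
  colour : ℕ → Fin k
  colour c = c mod k

  colouring : TotalColoring (K m □ P n) k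
  colouring = record
    { vc = colour ∘ vertexColour ∘ coordinates
    ; ec = λ u v → colour (edgeColour (coordinates u) (coordinates v))
    }

  InRange : ℕ × ℕ → Set
  InRange (i , j) = i < m × j < n

  coordinates-inRange : ∀ u → InRange (coordinates u)
  coordinates-inRange u = toℕ<n _ , toℕ<n _

  coordinates-combine : ∀ (i : Fin m) (j : Fin n) → coordinates (combine i j) ≡ (toℕ i , toℕ j)
  coordinates-combine i j = cong (λ (a , b) → toℕ a , toℕ b) (remQuot-combine {m} {n} i j)

  coordinates-injective : ∀ {u v} → coordinates u ≡ coordinates v → u ≡ v
  coordinates-injective {u} {v} eq = begin
    u                                  ≡⟨ combine-remQuot {m} n u ⟨
    uncurry combine (remQuot {m} n u)  ≡⟨ cong₂ combine (toℕ-injective (cong proj₁ eq)) (toℕ-injective (cong proj₂ eq)) ⟩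
    uncurry combine (remQuot {m} n v)  ≡⟨ combine-remQuot {m} n v ⟩
    v                                  ∎
    where open ≡-Reasoning

  adjacent⇒∼ : ∀ u v → adj (K m □ P n) u v ≡ true → coordinates u ∼ coordinates v
  adjacent⇒∼ u v =
    decode (proj₁ (remQuot {m} n u)) (proj₁ (remQuot {m} n v)) (proj₂ (remQuot {m} n u)) (proj₂ (remQuot {m} n v))
    where
    decode : ∀ (i i' : Fin m) (j j' : Fin n) → (⌊ i ≟ᶠ i' ⌋ ∧ adj (P n) j j') ∨ (not ⌊ i ≟ᶠ i' ⌋ ∧ ⌊ j ≟ᶠ j' ⌋) ≡ true →
             (toℕ i , toℕ j) ∼ (toℕ i' , toℕ j')
    decode i i' j j' adjacent with i ≟ᶠ i'
    ... | yes refl = pathAdjacent (toℕ i) (trans (sym (∨-identityʳ _)) adjacent)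
    ... | no i≢i' with j ≟ᶠ j'
    ...   | yes refl = column (i≢i' ∘ toℕ-injective)

  toℕ-colour : ∀ {c} → c < k → toℕ (colour c) ≡ c
  toℕ-colour c<k = trans (toℕ-fromℕ< _) (m<n⇒m%n≡m c<k)

  colour-injective : ∀ {c c'} → c < k → c' < k → colour c ≡ colour c' → c ≡ c'
  colour-injective c<k c'<k eq = trans (sym (toℕ-colour c<k)) (trans (cong toℕ eq) (toℕ-colour c'<k))

  edgeColour-row : ∀ i j j' → edgeColour (i , j) (i , j') ≡ π i (j ⊓ j')
  edgeColour-row i j j' = cong (if_then π i (j ⊓ j') else κ j i i) (dec-true (i ℕ.≟ i) refl)

  edgeColour-column : ∀ {i i' j j'} → i ≢ i' → edgeColour (i , j) (i' , j') ≡ κ j i i'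
  edgeColour-column {i} {i'} {j} {j'} i≢i' = cong (if_then π i (j ⊓ j') else κ j i i') (dec-false (i ℕ.≟ i') i≢i')

  edgeColour-forward : ∀ i j → edgeColour (i , j) (i , suc j) ≡ π i j
  edgeColour-forward i j = trans (edgeColour-row i j (suc j)) (cong (π i) (m≤n⇒m⊓n≡m (n≤1+n j)))

  edgeColour-backward : ∀ i j → edgeColour (i , suc j) (i , j) ≡ π i j
  edgeColour-backward i j = trans (edgeColour-row i (suc j) j) (cong (π i) (m≥n⇒m⊓n≡n (n≤1+n j)))

  module _ (admissible : Admissible) where
    open Admissible admissible

    edgeColour-comm : ∀ {p q} → p ∼ q → edgeColour p q ≡ edgeColour q p
    edgeColour-comm (column i≢i') = trans (edgeColour-column i≢i') (trans (κ-comm _ _ _) (sym (edgeColour-column (i≢i' ∘ sym))))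
    edgeColour-comm forward       = trans (edgeColour-forward _ _) (sym (edgeColour-backward _ _))
    edgeColour-comm backward      = trans (edgeColour-backward _ _) (sym (edgeColour-forward _ _))

    vertexColour<k : ∀ {p} → InRange p → vertexColour p < k
    vertexColour<k (i<m , _) = κ<k i<m i<m

    edgeColour<k : ∀ {p q} → p ∼ q → InRange p → InRange q → edgeColour p q < k
    edgeColour<k (column i≢i') (i<m , _) (i'<m , _) = subst (_< k) (sym (edgeColour-column i≢i')) (κ<k i<m i'<m)
    edgeColour<k forward  (i<m , _) (_ , 1+j<n) = subst (_< k) (sym (edgeColour-forward _ _)) (π<k i<m 1+j<n)
    edgeColour<k backward (i<m , 1+j<n) _       = subst (_< k) (sym (edgeColour-backward _ _)) (π<k i<m 1+j<n)

    vertexColour-proper : ∀ {p q} → p ∼ q → InRange p → InRange q → vertexColour p ≢ vertexColour q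
    vertexColour-proper (column i≢i') (i<m , _) (i'<m , _) = i≢i' ∘ κ-diagonal-injective i<m i'<m
    vertexColour-proper forward       (i<m , _) _          = κ-diagonal-step i<m
    vertexColour-proper backward      (i<m , _) _          = κ-diagonal-step i<m ∘ sym

    edgeColour≢vertexColour : ∀ {p q} → p ∼ q → InRange p → InRange q → edgeColour p q ≢ vertexColour p
    edgeColour≢vertexColour (column i≢i') (i<m , _) (i'<m , _) eq =
      i≢i' (κ-injective i<m i<m i'<m (trans (sym eq) (edgeColour-column i≢i')))
    edgeColour≢vertexColour forward  (i<m , _) _ eq = π-avoids-κ i<m i<m (inj₁ refl) (trans (sym (edgeColour-forward _ _)) eq)
    edgeColour≢vertexColour backward (i<m , _) _ eq = π-avoids-κ i<m i<m (inj₂ refl) (trans (sym (edgeColour-backward _ _)) eq)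

    edgeColour-proper : ∀ {p q r} → p ∼ q → p ∼ r → InRange p → InRange q → InRange r → q ≢ r →
                        edgeColour p q ≢ edgeColour p r
    edgeColour-proper (column i≢i') (column i≢i'') (i<m , _) (i'<m , _) (i''<m , _) q≢r eq =
      q≢r (cong (_, _) (κ-injective i<m i'<m i''<m (trans (sym (edgeColour-column i≢i')) (trans eq (edgeColour-column i≢i'')))))
    edgeColour-proper (column i≢i') forward (i<m , _) (i'<m , _) _ _ eq =
      π-avoids-κ i<m i'<m (inj₁ refl) (trans (sym (edgeColour-forward _ _)) (trans (sym eq) (edgeColour-column i≢i')))
    edgeColour-proper (column i≢i') backward (i<m , _) (i'<m , _) _ _ eq =
      π-avoids-κ i<m i'<m (inj₂ refl) (trans (sym (edgeColour-backward _ _)) (trans (sym eq) (edgeColour-column i≢i')))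
    edgeColour-proper forward  (column i≢i') p∈ q∈ r∈ q≢r = edgeColour-proper (column i≢i') forward  p∈ r∈ q∈ (q≢r ∘ sym) ∘ sym
    edgeColour-proper backward (column i≢i') p∈ q∈ r∈ q≢r = edgeColour-proper (column i≢i') backward p∈ r∈ q∈ (q≢r ∘ sym) ∘ sym
    edgeColour-proper forward  forward  _ _ _ q≢r = contradiction refl q≢r
    edgeColour-proper backward backward _ _ _ q≢r = contradiction refl q≢r
    edgeColour-proper forward backward (i<m , _) _ _ _ eq =
      π-step i<m (trans (sym (edgeColour-backward _ _)) (trans (sym eq) (edgeColour-forward _ _)))
    edgeColour-proper backward forward (i<m , _) _ _ _ eq =
      π-step i<m (trans (sym (edgeColour-backward _ _)) (trans eq (edgeColour-forward _ _)))

    coordinateWeight-proper : ∀ {p q} → p ∼ q → InRange p → InRange q → uncurry coordinateWeight p ≢ uncurry coordinateWeight q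
    coordinateWeight-proper (column i≢i') (i<m , _) (i'<m , _) = weight-column i<m i'<m i≢i'
    coordinateWeight-proper forward       (i<m , _) (_ , 1+j<n) = weight-row i<m 1+j<n
    coordinateWeight-proper backward      (i<m , 1+j<n) _       = weight-row i<m 1+j<n ∘ sym

    open TotalColoring colouring

    val-colour : ∀ {c} → c < k → val (colour c) ≡ suc c
    val-colour = cong suc ∘ toℕ-colour

    weight-combine : ∀ (i : Fin m) (j : Fin n) → weight colouring (combine i j) ≡ coordinateWeight (toℕ i) (toℕ j)
    weight-combine i j = begin
      weight colouring v
        ≡⟨ cong (val (vc v) +_) (trans (sum-map-allFin (m * n) _) (∑-neighbours i j (val ∘ ec v))) ⟩
      val (vc v) + (∑[ t < n ] (if adj (P n) j t then val (ec v (combine i t)) else 0)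
                    + ∑[ r < m' ] val (ec v (combine (punchIn i r) j)))
        ≡⟨ cong₂ _+_ vertexPart (cong₂ _+_ pathPart (sum-cong-≗ columnPart)) ⟩
      suc (κ j′ i′ i′) + (pathWeight + ∑[ r < m' ] suc (κ j′ i′ (toℕ (punchIn i r))))
        ≡⟨ cong (suc (κ j′ i′ i′) +_) (+-comm pathWeight _) ⟩
      suc (κ j′ i′ i′) + (∑[ r < m' ] suc (κ j′ i′ (toℕ (punchIn i r))) + pathWeight)
        ≡⟨ +-assoc (suc (κ j′ i′ i′)) _ pathWeight ⟨
      suc (κ j′ i′ i′) + ∑[ r < m' ] suc (κ j′ i′ (toℕ (punchIn i r))) + pathWeight
        ≡⟨ cong (_+ pathWeight) (sum-remove {i = i} (λ x → suc (κ j′ i′ (toℕ x)))) ⟨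
      coordinateWeight i′ j′
        ∎
      where
      open ≡-Reasoning
      v = combine i j
      i′ = toℕ i
      j′ = toℕ j
      pathWeight = leftEdge j′ (suc ∘ π i′) + rightEdge n j′ (suc ∘ π i′)
      ec-combine : ∀ i₁ j₁ → ec v (combine i₁ j₁) ≡ colour (edgeColour (i′ , j′) (toℕ i₁ , toℕ j₁))
      ec-combine i₁ j₁ = cong₂ (λ p q → colour (edgeColour p q)) (coordinates-combine i j) (coordinates-combine i₁ j₁)
      vertexPart : val (vc v) ≡ suc (κ j′ i′ i′)
      vertexPart = trans (cong (val ∘ colour ∘ vertexColour) (coordinates-combine i j))
                         (val-colour (vertexColour<k (toℕ<n i , toℕ<n j)))
      pathPart : ∑[ t < n ] (if adj (P n) j t then val (ec v (combine i t)) else 0) ≡ pathWeight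
      pathPart = ∑-pathNeighbours j _ (suc ∘ π i′) λ t adjacent →
        let v∼w = pathAdjacent i′ adjacent in
        trans (cong val (ec-combine i t))
              (trans (val-colour (edgeColour<k v∼w (toℕ<n i , toℕ<n j) (toℕ<n i , toℕ<n t)))
                     (cong suc (edgeColour-row i′ j′ (toℕ t))))
      columnPart : ∀ r → val (ec v (combine (punchIn i r) j)) ≡ suc (κ j′ i′ (toℕ (punchIn i r)))
      columnPart r = trans (cong val (ec-combine (punchIn i r) j))
        (trans (val-colour (edgeColour<k v∼w (toℕ<n i , toℕ<n j) (toℕ<n (punchIn i r) , toℕ<n j)))
               (cong suc (edgeColour-column i≢)))
        where
        i≢ : i′ ≢ toℕ (punchIn i r)
        i≢ = punchInᵢ≢i i r ∘ sym ∘ toℕ-injective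
        v∼w : (i′ , j′) ∼ (toℕ (punchIn i r) , j′)
        v∼w = column i≢

    weight≡coordinateWeight : ∀ u → weight colouring u ≡ uncurry coordinateWeight (coordinates u)
    weight≡coordinateWeight = ∀-combine {m} {n} λ i j →
      trans (weight-combine i j) (cong (uncurry coordinateWeight) (sym (coordinates-combine i j)))

    isProperSumDistinguishing : IsProperSumDistinguishing (K m □ P n) k colouring
    isProperSumDistinguishing = record
      { edge-sym      = λ u v u~v → cong colour (edgeColour-comm (adjacent⇒∼ u v u~v))
      ; vertex-proper = λ u v u~v eq → vertexColour-proper (adjacent⇒∼ u v u~v) (inRange u) (inRange v)
                          (colour-injective (vertexColour<k (inRange u)) (vertexColour<k (inRange v)) eq)
      ; edge-proper   = λ u v w u~v u~w v≢w eq → edgeColour-proper (adjacent⇒∼ u v u~v) (adjacent⇒∼ u w u~w)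
                          (inRange u) (inRange v) (inRange w) (v≢w ∘ coordinates-injective)
                          (colour-injective (edgeColour<k (adjacent⇒∼ u v u~v) (inRange u) (inRange v))
                                            (edgeColour<k (adjacent⇒∼ u w u~w) (inRange u) (inRange w)) eq)
      ; incidence     = λ u v u~v eq → edgeColour≢vertexColour (adjacent⇒∼ u v u~v) (inRange u) (inRange v)
                          (colour-injective (edgeColour<k (adjacent⇒∼ u v u~v) (inRange u) (inRange v))
                                            (vertexColour<k (inRange u)) eq)
      ; sums-distinct = λ u v u~v eq → coordinateWeight-proper (adjacent⇒∼ u v u~v) (inRange u) (inRange v)
                          (trans (sym (weight≡coordinateWeight u)) (trans eq (weight≡coordinateWeight v)))
      }
      where inRange = coordinates-inRange

  hasNSDTC : Admissible → HasNSDTC (K m □ P n) k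
  hasNSDTC admissible = colouring , isProperSumDistinguishing admissible

-- Arithmetic modulo M

module _ {M : ℕ} .{{_ : NonZero M}} where

  %-below-2M : ∀ {v} → v < M + M → v % M ≡ v ⊎ M + v % M ≡ v
  %-below-2M {v} v<2M with v ℕ.<? M
  ... | yes v<M = inj₁ (m<n⇒m%n≡m v<M)
  ... | no  v≮M = inj₂ (trans (cong (M +_) v%M≡v∸M) (m+[n∸m]≡n M≤v))
    where
    M≤v = ≮⇒≥ v≮M
    v%M≡v∸M : v % M ≡ v ∸ M
    v%M≡v∸M = trans (sym (m≤n⇒[n∸m]%m≡n%m M≤v)) (m<n⇒m%n≡m (subst (v ∸ M <_) (m+n∸m≡n M M) (∸-monoˡ-< v<2M M≤v)))

  %-window : ∀ {u v} → u ≤ v → v < M + M → u % M ≡ v % M → v ≡ u ⊎ v ≡ M + u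
  %-window {u} {v} u≤v v<2M eq with %-below-2M (≤-<-trans u≤v v<2M) | %-below-2M v<2M
  ... | inj₁ u%≡u | inj₁ v%≡v = inj₁ (trans (sym v%≡v) (trans (sym eq) u%≡u))
  ... | inj₁ u%≡u | inj₂ M+v%≡v = inj₂ (trans (sym M+v%≡v) (cong (M +_) (trans (sym eq) u%≡u)))
  ... | inj₂ M+u%≡u | inj₁ v%≡v =
    contradiction (subst (_≤ v) (sym (trans (cong (M +_) (trans (sym v%≡v) (sym eq))) M+u%≡u)) u≤v)
                  (<⇒≱ (m<n+m v (>-nonZero⁻¹ M)))
  ... | inj₂ M+u%≡u | inj₂ M+v%≡v = inj₁ (trans (sym M+v%≡v) (trans (cong (M +_) (sym eq)) M+u%≡u))

  private
    reduce : ∀ a {z} → z < M → (a + z) % M ≡ (a % M + z) % M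
    reduce a {z} z<M = trans (%-distribˡ-+ a z M) (cong (λ w → (a % M + w) % M) (m<n⇒m%n≡m z<M))

    +-%-injective-≤ : ∀ a {s t} → s ≤ t → t < M → (a + s) % M ≡ (a + t) % M → s ≡ t
    +-%-injective-≤ a {s} {t} s≤t t<M eq
      with %-window (+-monoʳ-≤ (a % M) s≤t) (+-mono-<-≤ (m%n<n a M) (<⇒≤ t<M))
                    (trans (sym (reduce a (≤-<-trans s≤t t<M))) (trans eq (reduce a t<M)))
    ... | inj₁ a′+t≡a′+s = sym (+-cancelˡ-≡ (a % M) t s a′+t≡a′+s)
    ... | inj₂ a′+t≡M+a′+s = contradiction t<M (≤⇒≯ (subst (M ≤_) (sym t≡M+s) (m≤m+n M s)))
      where
      t≡M+s : t ≡ M + s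
      t≡M+s = +-cancelˡ-≡ (a % M) t (M + s) (trans a′+t≡M+a′+s (+-comm-middle M (a % M) s))
        where
        +-comm-middle : ∀ x y z → x + (y + z) ≡ y + (x + z)
        +-comm-middle x y z = trans (sym (+-assoc x y z)) (trans (cong (_+ z) (+-comm x y)) (+-assoc y x z))

  +-%-injective : ∀ a {x y} → x < M → y < M → (a + x) % M ≡ (a + y) % M → x ≡ y
  +-%-injective a {x} {y} x<M y<M eq with ≤-total x y
  ... | inj₁ x≤y = +-%-injective-≤ a x≤y y<M eq
  ... | inj₂ y≤x = sym (+-%-injective-≤ a y≤x x<M (sym eq))

  ∑-rotate : ∀ a (f : ℕ → ℕ) → ∑[ s < M ] f ((a + toℕ s) % M) ≡ ∑[ s < M ] f (toℕ s)
  ∑-rotate a f = begin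
    ∑[ s < M ] f ((a + toℕ s) % M)    ≡⟨ sum-cong-≗ (cong f ∘ sym ∘ toℕ-σ) ⟩
    ∑[ s < M ] f (toℕ (σ s))          ≡⟨ ∑-injective M σ σ-injective (f ∘ toℕ) ⟩
    ∑[ s < M ] f (toℕ s)              ∎
    where
    open ≡-Reasoning
    σ : Fin M → Fin M
    σ s = (a + toℕ s) mod M
    toℕ-σ : ∀ s → toℕ (σ s) ≡ (a + toℕ s) % M
    toℕ-σ s = toℕ-fromℕ< _
    σ-injective : ∀ {s t} → σ s ≡ σ t → s ≡ t
    σ-injective {s} {t} eq =
      toℕ-injective (+-%-injective a (toℕ<n s) (toℕ<n t) (trans (sym (toℕ-σ s)) (trans (cong toℕ eq) (toℕ-σ t))))

  %-suc≢ : 1 < M → ∀ x → suc x % M ≢ x % M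
  %-suc≢ 1<M x eq =
    1+n≢0 (+-%-injective x 1<M (>-nonZero⁻¹ M) (trans (cong (_% M) (+-comm x 1)) (trans eq (cong (_% M) (sym (+-identityʳ x))))))

even : ℕ → Bool
even zero    = true
even (suc j) = not (even j)

evenBit : ℕ → ℕ
evenBit j = if even j then 1 else 0

even? : ∀ p → even p ≡ true ⊎ even p ≡ false
even? p with even p
... | true  = inj₁ refl
... | false = inj₂ refl

evenBit≤1 : ∀ j → evenBit j ≤ 1
evenBit≤1 j = bit≤1 (even j)
  where
  bit≤1 : ∀ b → (if b then 1 else 0) ≤ 1
  bit≤1 true  = ≤-refl
  bit≤1 false = z≤n

exchange : ∀ a b x y p q {T} → a + x ≡ T → b + y ≡ T → a + p ≡ b + q → p + y ≡ q + x
exchange a b x y p q {T} a+x≡T b+y≡T a+p≡b+q = +-cancelʳ-≡ T _ _ (begin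
  p + y + T               ≡⟨ cong (p + y +_) a+x≡T ⟨
  p + y + (a + x)         ≡⟨ l₁ p y a x ⟩
  (a + p) + (x + y)       ≡⟨ cong (_+ (x + y)) a+p≡b+q ⟩
  (b + q) + (x + y)       ≡⟨ l₂ b q x y ⟩
  q + x + (b + y)         ≡⟨ cong (q + x +_) b+y≡T ⟩
  q + x + T               ∎)
  where
  open ≡-Reasoning
  l₁ : ∀ p y a x → p + y + (a + x) ≡ (a + p) + (x + y)
  l₁ = solve-∀
  l₂ : ∀ b q x y → (b + q) + (x + y) ≡ q + x + (b + y)
  l₂ = solve-∀

-- The classical total colouring of K m by ℤ/M (vertex i ↦ 2 i, edge i i' ↦ i + i'), shifted by d and by
-- one more on even columns; at (i, j) exactly the d colours i + t + evenBit j (t < d) are missing.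
module CyclicColouring (m' d : ℕ) where

  m M : ℕ
  m = suc m'
  M = m + d

  shift : ℕ → ℕ
  shift j = evenBit j + d

  κ : ℕ → ℕ → ℕ → ℕ
  κ j i i' = (shift j + i + i') % M

  colourSum : ℕ → ℕ → ℕ
  colourSum i j = ∑[ i' < m ] suc (κ j i (toℕ i'))

  missing : ℕ → ℕ → ℕ
  missing i j = ∑[ t < d ] suc (i + toℕ t + evenBit j)

  κ<M : ∀ j i i' → κ j i i' < M
  κ<M j i i' = m%n<n (shift j + i + i') M

  κ-comm : ∀ j i i' → κ j i i' ≡ κ j i' i
  κ-comm j i i' = cong (_% M) (+-comm-right (shift j) i i')
    where
    +-comm-right : ∀ a b c → a + b + c ≡ a + c + b
    +-comm-right = solve-∀

  κ-injective : ∀ {j i i' i''} → i' < m → i'' < m → κ j i i' ≡ κ j i i'' → i' ≡ i''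
  κ-injective {j} {i} i'<m i''<m = +-%-injective (shift j + i) (≤-trans i'<m (m≤m+n m d)) (≤-trans i''<m (m≤m+n m d))

  κ-argument<2M : ∀ j {i i'} → i < m → i' < m → shift j + i + i' < M + M
  κ-argument<2M j {i} {i'} i<m i'<m = begin-strict
    evenBit j + d + i + i'  ≤⟨ +-mono-≤ (+-mono-≤ (+-monoˡ-≤ d (evenBit≤1 j)) (s≤s⁻¹ i<m)) (s≤s⁻¹ i'<m) ⟩
    1 + d + m' + m'         ≡⟨ rearrange d m' ⟩
    M + m'                  <⟨ +-monoʳ-< M (≤-trans (n<1+n m') (m≤m+n m d)) ⟩
    M + M                   ∎
    where
    open ≤-Reasoning
    rearrange : ∀ d m' → 1 + d + m' + m' ≡ suc m' + d + m'
    rearrange = solve-∀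

  κ-diagonal-step : 1 < M → ∀ {j i} → κ j i i ≢ κ (suc j) i i
  κ-diagonal-step 1<M {j} {i} with even j
  ... | true  = %-suc≢ 1<M (d + i + i)
  ... | false = %-suc≢ 1<M (d + i + i) ∘ sym

  private
    doubling : ∀ s x → s + x + x ≡ s + 2 * x
    doubling = solve-∀

    odd-shift : ∀ s h x → suc (2 * h) + (s + x + x) ≡ s + suc (2 * (h + x))
    odd-shift = solve-∀

    -- 2 i' ≡ 2 i + M is impossible because M is odd
    κ-diagonal-injective-≤ : ∀ h → M ≡ suc (2 * h) → ∀ {j i i'} → i ≤ i' → i' < m → κ j i i ≡ κ j i' i' → i ≡ i'
    κ-diagonal-injective-≤ h M≡ {j} {i} {i'} i≤i' i'<m eq
      with %-window (+-mono-≤ (+-monoʳ-≤ (shift j) i≤i') i≤i') (κ-argument<2M j i'<m i'<m) eq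
    ... | inj₁ same = sym (*-cancelˡ-≡ i' i 2 (+-cancelˡ-≡ (shift j) _ _
      (trans (sym (doubling (shift j) i')) (trans same (doubling (shift j) i)))))
    ... | inj₂ wrapped = contradiction (+-cancelˡ-≡ (shift j) _ _
      (trans (sym (doubling (shift j) i')) (trans wrapped (trans (cong (_+ (shift j + i + i)) M≡) (odd-shift (shift j) h i)))))
      (even≢odd i' (h + i))

  κ-diagonal-injective : ∀ h → M ≡ suc (2 * h) → ∀ {j i i'} → i < m → i' < m → κ j i i ≡ κ j i' i' → i ≡ i'
  κ-diagonal-injective h M≡ {j} {i} {i'} i<m i'<m eq with ≤-total i i'
  ... | inj₁ i≤i' = κ-diagonal-injective-≤ h M≡ {j} i≤i' i'<m eq
  ... | inj₂ i'≤i = sym (κ-diagonal-injective-≤ h M≡ {j} i'≤i i<m (sym eq))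

  missing-term<M : ∀ j {i t} → i < m → t < d → i + t + evenBit j < M
  missing-term<M j {i} {t} i<m t<d = begin-strict
    i + t + evenBit j  ≤⟨ +-mono-≤ (+-monoˡ-≤ t (s≤s⁻¹ i<m)) (evenBit≤1 j) ⟩
    m' + t + 1         ≡⟨ +-comm (m' + t) 1 ⟩
    m + t              <⟨ +-monoʳ-< m t<d ⟩
    M                  ∎
    where open ≤-Reasoning

  missing-as-κ : ∀ j {i t} → i < m → t < d → (shift j + i + (m + t)) % M ≡ i + t + evenBit j
  missing-as-κ j {i} {t} i<m t<d = begin
    (shift j + i + (m + t)) % M    ≡⟨ cong (_% M) (rearrange (evenBit j) d i m t) ⟩
    (i + t + evenBit j + M) % M    ≡⟨ [m+n]%n≡m%n (i + t + evenBit j) M ⟩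
    (i + t + evenBit j) % M        ≡⟨ m<n⇒m%n≡m (missing-term<M j i<m t<d) ⟩
    i + t + evenBit j              ∎
    where
    open ≡-Reasoning
    rearrange : ∀ e d i m t → e + d + i + (m + t) ≡ i + t + e + (m + d)
    rearrange = solve-∀

  κ-avoids-missing : ∀ {j i i' t} → i < m → i' < m → t < d → κ j i i' ≢ i + t + evenBit j
  κ-avoids-missing {j} {i} {i'} {t} i<m i'<m t<d eq =
    <⇒≱ i'<m (subst (m ≤_) (sym i'≡m+t) (m≤m+n m t))
    where
    i'≡m+t : i' ≡ m + t
    i'≡m+t = +-%-injective (shift j + i) (≤-trans i'<m (m≤m+n m d)) (+-monoʳ-< m t<d) (trans eq (sym (missing-as-κ j i<m t<d)))

  κ-rowSum : ∀ j {i} → i < m → colourSum i j + missing i j ≡ ∑[ s < M ] suc (toℕ s)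
  κ-rowSum j {i} i<m = begin
    ∑[ i' < m ] suc (κ j i (toℕ i')) + missing i j
      ≡⟨ cong₂ _+_ (sum-cong-≗ {m} (λ s → cong (λ x → suc ((shift j + i + x) % M)) (sym (toℕ-↑ˡ s d))))
                   (sum-cong-≗ {d} (λ t → cong suc (trans (sym (missing-as-κ j i<m (toℕ<n t)))
                                                          (cong (λ x → (shift j + i + x) % M) (sym (toℕ-↑ʳ m t)))))) ⟩
    ∑[ s < m ] rotated (s ↑ˡ d) + ∑[ t < d ] rotated (m ↑ʳ t)
      ≡⟨ ∑-↑ m d rotated ⟨
    ∑[ s < M ] rotated s
      ≡⟨ ∑-rotate (shift j + i) suc ⟩
    ∑[ s < M ] suc (toℕ s)
      ∎
    where
    open ≡-Reasoning
    rotated : Fin M → ℕ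
    rotated s = suc ((shift j + i + toℕ s) % M)

  -- The K m colours at a vertex together with its missing colours are 0, …, M - 1, so comparing two
  -- weights reduces to comparing path colours against missing colours.
  module Weights (n k' : ℕ) (π : ℕ → ℕ → ℕ) where
    open CoordinateColouring m' n k' κ π using (coordinateWeight)

    pathWeight : ℕ → ℕ → ℕ
    pathWeight i j = leftEdge j (suc ∘ π i) + rightEdge n j (suc ∘ π i)

    weight-column-from : ∀ {i i' j} → i < m → i' < m →
      pathWeight i j + missing i' j ≢ pathWeight i' j + missing i j → coordinateWeight i j ≢ coordinateWeight i' j
    weight-column-from {i} {i'} {j} i<m i'<m ≢ =
      ≢ ∘ exchange (colourSum i j) (colourSum i' j) (missing i j) (missing i' j) (pathWeight i j) (pathWeight i' j)
                   (κ-rowSum j i<m) (κ-rowSum j i'<m)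

    weight-row-from : ∀ {i j} → i < m → suc j < n →
      leftEdge j (suc ∘ π i) + missing i (suc j) ≢ rightEdge n (suc j) (suc ∘ π i) + missing i j →
      coordinateWeight i j ≢ coordinateWeight i (suc j)
    weight-row-from {i} {j} i<m 1+j<n ≢ eq = ≢ (+-cancelˡ-≡ shared _ _ (begin
      shared + (left + missing i (suc j))        ≡⟨ regroup shared left (missing i (suc j)) ⟩
      left + shared + missing i (suc j)          ≡⟨ cong (λ r → left + r + missing i (suc j)) (rightEdge-inner (suc ∘ π i) 1+j<n) ⟨
      pathWeight i j + missing i (suc j)         ≡⟨ exchanged ⟩
      shared + right + missing i j               ≡⟨ +-assoc shared right (missing i j) ⟩
      shared + (right + missing i j)             ∎))
      where
      open ≡-Reasoning
      left = leftEdge j (suc ∘ π i)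
      right = rightEdge n (suc j) (suc ∘ π i)
      shared = suc (π i j)
      exchanged : pathWeight i j + missing i (suc j) ≡ pathWeight i (suc j) + missing i j
      exchanged = exchange (colourSum i j) (colourSum i (suc j)) (missing i j) (missing i (suc j))
                           (pathWeight i j) (pathWeight i (suc j)) (κ-rowSum j i<m) (κ-rowSum (suc j) i<m) eq
      regroup : ∀ c a x → c + (a + x) ≡ a + c + x
      regroup = solve-∀

X+δ≢0∨X : ∀ {X δ b} → δ ≢ 0 → b ≡ 0 ⊎ b ≡ X → X + δ ≢ b
X+δ≢0∨X {X} {zero}  δ≢0 _          = contradiction refl δ≢0
X+δ≢0∨X {X} {suc δ} _   (inj₁ refl) = m+1+n≢0 X
X+δ≢0∨X {X} {suc δ} _   (inj₂ refl) = m+1+n≢m X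

+-≢0∨X : ∀ {X δ a b} → δ ≢ 0 → δ ≢ X → a ≡ 0 ⊎ a ≡ X → b ≡ 0 ⊎ b ≡ X → a + δ ≢ b
+-≢0∨X δ≢0 δ≢X (inj₁ refl) (inj₁ refl) = δ≢0
+-≢0∨X δ≢0 δ≢X (inj₁ refl) (inj₂ refl) = δ≢X
+-≢0∨X δ≢0 δ≢X (inj₂ refl) b∈         = X+δ≢0∨X δ≢0 b∈

cancel-middle : ∀ a b c x y → a + (c + x) ≡ b + (c + y) → a + x ≡ b + y
cancel-middle a b c x y eq = +-cancelˡ-≡ c _ _ (trans (swap a c x) (trans eq (sym (swap b c y))))
  where
  swap : ∀ a c x → c + (a + x) ≡ a + (c + x)
  swap = solve-∀

+-double-injective : ∀ {i j} → i + i ≡ j + j → i ≡ j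
+-double-injective {i} {j} eq = *-cancelˡ-≡ i j 2 (trans (double i) (trans eq (sym (double j))))
  where
  double : ∀ x → 2 * x ≡ x + x
  double = solve-∀

-- m even, M = m + 1: one colour is missing at each vertex, so the path edges alternate the extra colours M, M + 1.
module EvenOrder (m' h n k' : ℕ) (m≡2h : suc m' ≡ 2 * h)
                 (M<k : suc m' + 1 < suc k') (odd-edges : 3 ≤ n → suc (suc m' + 1) < suc k') where

  open CyclicColouring m' 1

  π : ℕ → ℕ → ℕ
  π _ p = if even p then M else suc M

  open CoordinateColouring m' n k' κ π
  open Weights n k' π

  M≤π : ∀ i p → M ≤ π i p
  M≤π i p with even p
  ... | true  = ≤-refl
  ... | false = n≤1+n M

  missing≡ : ∀ i j → missing i j ≡ suc i + evenBit j
  missing≡ i j = shape i (evenBit j)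
    where
    shape : ∀ i e → suc (i + 0 + e) + 0 ≡ suc i + e
    shape = solve-∀

  row-equation : ∀ {a b i j} → a + missing i (suc j) ≡ b + missing i j → a + evenBit (suc j) ≡ b + evenBit j
  row-equation {a} {b} {i} {j} eq =
    cancel-middle a b (suc i) _ _ (trans (cong (a +_) (sym (missing≡ i (suc j)))) (trans eq (cong (b +_) (missing≡ i j))))

  private
    row-condition-suc : ∀ b {r} → r ≡ 0 ⊎ r ≡ suc (if not (not b) then M else suc M) →
      suc (if b then M else suc M) + (if not (not b) then 1 else 0) ≢ r + (if not b then 1 else 0)
    row-condition-suc true  r∈ eq = X+δ≢0∨X (λ ()) r∈ (trans eq (+-identityʳ _))
    row-condition-suc false r∈ eq = +-≢0∨X (λ ()) (λ ()) r∈ (inj₂ refl) (sym (trans (sym (+-identityʳ _)) eq))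

  row-condition : ∀ i j → leftEdge j (suc ∘ π i) + missing i (suc j) ≢ rightEdge n (suc j) (suc ∘ π i) + missing i j
  row-condition i zero    = m+1+n≢0 _ ∘ sym ∘ row-equation {i = i} {j = 0}
  row-condition i (suc p) =
    row-condition-suc (even p) (rightEdge-cases n (suc (suc p)) (suc ∘ π i)) ∘ row-equation {i = i} {j = suc p}

  admissible : Admissible
  admissible = record
    { κ<k                  = λ {j} {i} {i'} _ _ → <-trans (κ<M j i i') M<k
    ; π<k                  = π<k
    ; κ-comm               = κ-comm
    ; κ-injective          = λ {j} {i} _ → κ-injective {j} {i}
    ; κ-diagonal-injective = λ {j} → κ-diagonal-injective h M≡1+2h {j}
    ; κ-diagonal-step      = λ {j} {i} _ → κ-diagonal-step (s≤s (m≤n+m 1 m')) {j} {i}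
    ; π-avoids-κ           = λ {i} {i'} {p} {j} _ _ _ eq → <⇒≢ (<-≤-trans (κ<M j i i') (M≤π i p)) (sym eq)
    ; π-step               = λ {i} {p} _ → π-step {i} p
    ; weight-column        = λ {i} {i'} {j} i<m i'<m i≢i' → weight-column-from i<m i'<m (i≢i' ∘ sym ∘ missing-injective j)
    ; weight-row           = λ {i} {j} i<m 1+j<n → weight-row-from i<m 1+j<n (row-condition i j)
    }
    where
    M≡1+2h : M ≡ suc (2 * h)
    M≡1+2h = trans (+-comm (suc m') 1) (cong suc m≡2h)
    π<k : ∀ {i p} → i < suc m' → suc p < n → π i p < suc k'
    π<k {p = zero}  _ _     = M<k
    π<k {p = suc p} _ 2+p<n with even (suc p)
    ... | true  = M<k
    ... | false = odd-edges (≤-trans (s≤s (s≤s (s≤s z≤n))) 2+p<n)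
    π-step : ∀ {i} p → π i p ≢ π i (suc p)
    π-step p with even p
    ... | true  = 1+n≢n ∘ sym
    ... | false = 1+n≢n
    missing-injective : ∀ j {i i'} → pathWeight i j + missing i' j ≡ pathWeight i' j + missing i j → i' ≡ i
    missing-injective j {i} {i'} eq =
      +-cancelʳ-≡ (evenBit j) i' i (suc-injective
        (trans (sym (missing≡ i' j)) (trans (+-cancelˡ-≡ (pathWeight i j) _ _ eq) (missing≡ i j))))

-- m odd, M = m + 2: the even path edges of row i get i + 1, which is missing at both of their ends, the odd ones
-- the extra colour M.
module OddOrder (m' h n k' : ℕ) (m≡1+2h : suc m' ≡ suc (2 * h))
                (M≤k : suc m' + 2 ≤ suc k') (odd-edges : 3 ≤ n → suc m' + 2 < suc k') where

  open CyclicColouring m' 2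

  π : ℕ → ℕ → ℕ
  π i p = if even p then suc i else M

  open CoordinateColouring m' n k' κ π
  open Weights n k' π

  1+i<M : ∀ {i} → i < m → suc i < M
  1+i<M i<m = s≤s (≤-trans i<m (m<m+n m' z<s))

  missing≡ : ∀ i j → missing i j ≡ i + i + 3 + (evenBit j + evenBit j)
  missing≡ i j = shape i (evenBit j)
    where
    shape : ∀ i e → suc (i + 0 + e) + (suc (i + 1 + e) + 0) ≡ i + i + 3 + (e + e)
    shape = solve-∀

  π-even : ∀ {i p} → even p ≡ true → π i p ≡ suc i
  π-even {i} = cong (if_then suc i else M)

  π-odd : ∀ {i p} → even p ≡ false → π i p ≡ M
  π-odd {i} = cong (if_then suc i else M)

  π-avoids-κ : ∀ {i i' p j} → i < m → i' < m → (j ≡ p ⊎ j ≡ suc p) → π i p ≢ κ j i i'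
  π-avoids-κ {i} {i'} {p} {j} i<m i'<m j∈ eq with even? p
  ... | inj₂ odd = <⇒≢ (κ<M j i i') (trans (sym eq) (π-odd {i} {p} odd))
  ... | inj₁ ev with j∈
  ...   | inj₁ refl = κ-avoids-missing {p} {i} {i'} {0} i<m i'<m (s≤s z≤n)
                        (trans (sym eq) (trans (π-even {i} {p} ev) (sym (first ev))))
    where
    first : even p ≡ true → i + 0 + evenBit p ≡ suc i
    first e = trans (cong (λ b → i + 0 + (if b then 1 else 0)) e) (trans (+-comm (i + 0) 1) (cong suc (+-identityʳ i)))
  ...   | inj₂ refl = κ-avoids-missing {suc p} {i} {i'} {1} i<m i'<m (s≤s (s≤s z≤n))
                        (trans (sym eq) (trans (π-even {i} {p} ev) (sym (second ev))))
    where
    second : even p ≡ true → i + 1 + evenBit (suc p) ≡ suc i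
    second e = trans (cong (λ b → i + 1 + (if not b then 1 else 0)) e) (trans (+-identityʳ (i + 1)) (+-comm i 1))

  private
    shift-out : ∀ i x → suc (suc i) + x ≡ i + (2 + x)
    shift-out = solve-∀
    shift-out′ : ∀ i x → x + suc (suc i) ≡ i + (x + 2)
    shift-out′ = solve-∀

  pathWeight-shape : ∀ j → Σ ℕ λ c → (∀ i → pathWeight i j ≡ c) ⊎ (∀ i → pathWeight i j ≡ i + c)
  pathWeight-shape zero with 1 <ᵇ n
  ... | true  = 2 , inj₂ (λ i → +-comm 2 i)
  ... | false = 0 , inj₁ (λ _ → refl)
  pathWeight-shape (suc p) with even p | suc (suc p) <ᵇ n
  ... | true  | true  = 2 + suc M , inj₂ (λ i → shift-out i (suc M))
  ... | true  | false = 2 , inj₂ (λ i → shift-out i 0)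
  ... | false | true  = suc M + 2 , inj₂ (λ i → shift-out′ i (suc M))
  ... | false | false = suc M + 0 , inj₁ (λ _ → refl)

  column-condition : ∀ j {i i'} → pathWeight i j + missing i' j ≡ pathWeight i' j + missing i j → i' ≡ i
  column-condition j {i} {i'} eq with pathWeight-shape j
  ... | c , inj₁ constant = +-double-injective (+-cancelʳ-≡ 3 _ _ (+-cancelʳ-≡ E _ _ (+-cancelˡ-≡ c _ _ (begin
    c + (i' + i' + 3 + E)       ≡⟨ cong₂ _+_ (sym (constant i)) (sym (missing≡ i' j)) ⟩
    pathWeight i j + missing i' j ≡⟨ eq ⟩
    pathWeight i' j + missing i j ≡⟨ cong₂ _+_ (constant i') (missing≡ i j) ⟩
    c + (i + i + 3 + E)         ∎))))
    where
    open ≡-Reasoning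
    E = evenBit j + evenBit j
  ... | c , inj₂ linear = +-cancelʳ-≡ Z i' i (begin
    i' + Z                          ≡⟨ regroup i i' c E ⟨
    i + c + (i' + i' + 3 + E)       ≡⟨ cong₂ _+_ (sym (linear i)) (sym (missing≡ i' j)) ⟩
    pathWeight i j + missing i' j   ≡⟨ eq ⟩
    pathWeight i' j + missing i j   ≡⟨ cong₂ _+_ (linear i') (missing≡ i j) ⟩
    i' + c + (i + i + 3 + E)        ≡⟨ regroup′ i i' c E ⟩
    i + Z                           ∎)
    where
    open ≡-Reasoning
    E = evenBit j + evenBit j
    Z = i + i' + c + 3 + E
    regroup : ∀ i i' c E → i + c + (i' + i' + 3 + E) ≡ i' + (i + i' + c + 3 + E)
    regroup = solve-∀
    regroup′ : ∀ i i' c E → i' + c + (i + i + 3 + E) ≡ i + (i + i' + c + 3 + E)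
    regroup′ = solve-∀

  row-equation : ∀ {a b i j} → a + missing i (suc j) ≡ b + missing i j →
                 a + (evenBit (suc j) + evenBit (suc j)) ≡ b + (evenBit j + evenBit j)
  row-equation {a} {b} {i} {j} eq =
    cancel-middle a b (i + i + 3) _ _ (trans (cong (a +_) (sym (missing≡ i (suc j)))) (trans eq (cong (b +_) (missing≡ i j))))

  private
    2≢1+M : 2 ≢ suc M
    2≢1+M eq = m+1+n≢0 m' (sym (suc-injective (suc-injective eq)))

    twice : Bool → ℕ
    twice b = (if b then 1 else 0) + (if b then 1 else 0)

    row-condition-suc : ∀ i b {r} → r ≡ 0 ⊎ r ≡ suc (if not (not b) then suc i else M) →
      suc (if b then suc i else M) + twice (not (not b)) ≢ r + twice (not b)
    row-condition-suc i true  r∈ eq = X+δ≢0∨X (λ ()) r∈ (trans eq (+-identityʳ _))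
    row-condition-suc i false r∈ eq = +-≢0∨X (λ ()) 2≢1+M r∈ (inj₂ refl) (sym (trans (sym (+-identityʳ _)) eq))

  row-condition : ∀ i j → leftEdge j (suc ∘ π i) + missing i (suc j) ≢ rightEdge n (suc j) (suc ∘ π i) + missing i j
  row-condition i zero    = m+1+n≢0 _ ∘ sym ∘ row-equation {i = i} {j = 0}
  row-condition i (suc p) =
    row-condition-suc i (even p) (rightEdge-cases n (suc (suc p)) (suc ∘ π i)) ∘ row-equation {i = i} {j = suc p}

  admissible : Admissible
  admissible = record
    { κ<k                  = λ {j} {i} {i'} _ _ → <-≤-trans (κ<M j i i') M≤k
    ; π<k                  = π<k
    ; κ-comm               = κ-comm
    ; κ-injective          = λ {j} {i} _ → κ-injective {j} {i}
    ; κ-diagonal-injective = λ {j} → κ-diagonal-injective (suc h) M≡1+2[1+h] {j}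
    ; κ-diagonal-step      = λ {j} {i} _ → κ-diagonal-step (s≤s (≤-trans (s≤s z≤n) (m≤n+m 2 m'))) {j} {i}
    ; π-avoids-κ           = π-avoids-κ
    ; π-step               = λ {i} {p} → π-step {i} {p}
    ; weight-column        = λ {i} {i'} {j} i<m i'<m i≢i' → weight-column-from i<m i'<m (i≢i' ∘ sym ∘ column-condition j)
    ; weight-row           = λ {i} {j} i<m 1+j<n → weight-row-from i<m 1+j<n (row-condition i j)
    }
    where
    M≡1+2[1+h] : M ≡ suc (2 * suc h)
    M≡1+2[1+h] = trans (cong (_+ 2) m≡1+2h) (shape h)
      where
      shape : ∀ h → suc (2 * h) + 2 ≡ suc (2 * suc h)
      shape = solve-∀
    π<k : ∀ {i p} → i < m → suc p < n → π i p < suc k'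
    π<k {i} {p} i<m 1+p<n with even? p
    ... | inj₁ ev = subst (_< suc k') (sym (π-even {i} {p} ev)) (<-≤-trans (1+i<M i<m) M≤k)
    ... | inj₂ od = subst (_< suc k') (sym (π-odd {i} {p} od)) (odd-edges (odd⇒3≤ p od 1+p<n))
      where
      odd⇒3≤ : ∀ p → even p ≡ false → suc p < n → 3 ≤ n
      odd⇒3≤ (suc p) _ 2+p<n = ≤-trans (s≤s (s≤s (s≤s z≤n))) 2+p<n
    π-step : ∀ {i p} → i < m → π i p ≢ π i (suc p)
    π-step {i} {p} i<m with even p
    ... | true  = <⇒≢ (1+i<M i<m)
    ... | false = <⇒≢ (1+i<M i<m) ∘ sym

even-or-odd : ∀ m → Σ[ h ∈ ℕ ] (m ≡ 2 * h ⊎ m ≡ suc (2 * h))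
even-or-odd zero = 0 , inj₁ refl
even-or-odd (suc m) with even-or-odd m
... | h , inj₁ m≡2h   = h , inj₂ (cong suc m≡2h)
... | h , inj₂ m≡1+2h = suc h , inj₁ (trans (cong suc m≡1+2h) (cong suc (sym (+-suc h (h + 0)))))

K□P-hasNSDTC : ∀ m' n k' → suc m' + 1 < suc k' → (3 ≤ n → suc m' + 2 < suc k') → HasNSDTC (K (suc m') □ P n) (suc k')
K□P-hasNSDTC m' n k' m+1<k long⇒m+2<k with even-or-odd (suc m')
... | h , inj₁ m≡2h   = CoordinateColouring.hasNSDTC m' n k' _ _
  (EvenOrder.admissible m' h n k' m≡2h m+1<k (subst (_< suc k') (cong suc (+-suc m' 1)) ∘ long⇒m+2<k))
... | h , inj₂ m≡1+2h = CoordinateColouring.hasNSDTC m' n k' _ _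
  (OddOrder.admissible m' h n k' m≡1+2h (subst (_≤ suc k') (sym (cong suc (+-suc m' 1))) m+1<k) long⇒m+2<k)

theorem4p4 : (m n : ℕ) → 2 ≤ m → 2 ≤ n →
    ChiSigmaIs (K m □ P n) (maxDegree (K m □ P n) + 2)
theorem4p4 (suc zero)     _          (s≤s ()) _
theorem4p4 (suc (suc m')) (suc zero) _        (s≤s ())
theorem4p4 (suc (suc m')) (suc (suc zero)) _ _ =
  K□P-χ''Σ m' 2 zero (maxDegree-K□P₂ (suc m'))
    (K□P-hasNSDTC (suc m') 2 (suc m' + 2) (+-monoʳ-< (2 + m') ≤-refl) λ { (s≤s (s≤s ())) })
theorem4p4 (suc (suc m')) (suc (suc (suc n'))) _ _ =
  K□P-χ''Σ m' (3 + n') (suc zero) (maxDegree-K□P₃₊ (suc m') n')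
    (K□P-hasNSDTC (suc m') (3 + n') (suc (suc m' + 2)) (<-trans (+-monoʳ-< (2 + m') ≤-refl) (n<1+n _)) (λ _ → ≤-refl))
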